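{- Let $\mathbf{Q}$ be a finite flat QB-algebra, and suppose the set $\{x\in Q: x^{*}=x\}$ has exactly $k$ elements. Then $|Q|=m+k$ for some even integer $m$. In particular, if $k=1$ then $|Q|$ is odd.
   Context: A quasi-lattice is an algebra $\langle L;\vee,\wedge\rangle$ such that for all $x,y,z$: $\vee,\wedge$ are commutative and associative; $x\vee(x\wedge y)=x\vee x$ and $x\wedge(x\vee y)=x\wedge x$; $x\vee(y\vee y)=x\vee y$ and $x\wedge(y\wedge y)=x\wedge y$; $x\vee x=x\wedge x$; distributive if both distributive laws hold. A QB-algebra is an algebra $\langle Q;\vee,\wedge,{}^{*},0,1\rangle$ of type $\langle 2,2,1,0,0\rangle$ such that $\langle Q;\vee,\wedge\rangle$ is a distributive quasi-lattice and for all $x$: $x\vee 1=1$, $x\wedge 0=0$, $x\vee x^{*}=1$, $x\wedge x^{*}=0$, $(x\wedge x)^{*}=x^{*}\vee x^{*}$, $x^{**}=x$. A QB-algebra is flat if $1=0$. -}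

module Defs where

open import Level using (Level; suc; _⊔_)
open import Relation.Binary.PropositionalEquality using (_≡_)

record IsDistributiveQuasiLattice {a} {L : Set a} (_∨_ _∧_ : L → L → L) : Set a where
  field
    ∨-comm   : ∀ x y → (x ∨ y) ≡ (y ∨ x)
    ∧-comm   : ∀ x y → (x ∧ y) ≡ (y ∧ x)
    ∨-assoc  : ∀ x y z → ((x ∨ y) ∨ z) ≡ (x ∨ (y ∨ z))
    ∧-assoc  : ∀ x y z → ((x ∧ y) ∧ z) ≡ (x ∧ (y ∧ z))
    ∨-absorb : ∀ x y → (x ∨ (x ∧ y)) ≡ (x ∨ x)
    ∧-absorb : ∀ x y → (x ∧ (x ∨ y)) ≡ (x ∧ x)
    ∨-idem-r : ∀ x y → (x ∨ (y ∨ y)) ≡ (x ∨ y)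
    ∧-idem-r : ∀ x y → (x ∧ (y ∧ y)) ≡ (x ∧ y)
    ∨∧-same  : ∀ x → (x ∨ x) ≡ (x ∧ x)
    ∧-distrib-∨ : ∀ x y z → (x ∧ (y ∨ z)) ≡ ((x ∧ y) ∨ (x ∧ z))
    ∨-distrib-∧ : ∀ x y z → (x ∨ (y ∧ z)) ≡ ((x ∨ y) ∧ (x ∨ z))

record QBAlgebra (a : Level) : Set (suc a) where
  infixr 6 _∨_
  infixr 7 _∧_
  field
    Carrier : Set a
    _∨_ _∧_ : Carrier → Carrier → Carrier
    _* : Carrier → Carrier
    𝟘 𝟙 : Carrier
    isDistributiveQuasiLattice : IsDistributiveQuasiLattice _∨_ _∧_
    ∨-one     : ∀ x → (x ∨ 𝟙) ≡ 𝟙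
    ∧-zero    : ∀ x → (x ∧ 𝟘) ≡ 𝟘
    ∨-compl   : ∀ x → (x ∨ (x *)) ≡ 𝟙
    ∧-compl   : ∀ x → (x ∧ (x *)) ≡ 𝟘
    *-∧∧      : ∀ x → ((x ∧ x) *) ≡ ((x *) ∨ (x *))
    *-invol   : ∀ x → ((x *) *) ≡ x

  open IsDistributiveQuasiLattice isDistributiveQuasiLattice public

Flat : ∀ {a} → QBAlgebra a → Set a
Flat Q = QBAlgebra.𝟙 Q ≡ QBAlgebra.𝟘 Q

-- A QB-algebra's complement * is an involution, so a finite carrier splits into the fixed
-- points of * and the two-element orbits {x, x*}; hence |Q| − k is even.  Counting is done
-- over Fin n: every index i is exactly one of i < f i, i = f i, f i < i, and the involution
-- f swaps the first and third classes, so they have the same size.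

module Submission where

open import Defs
open import Level using (Level)
open import Data.Nat using (ℕ; _+_)
open import Data.Fin using (Fin)
open import Data.Product using (Σ; ∃; _×_)
open import Function.Bundles using (_↔_)
open import Relation.Binary.PropositionalEquality using (_≡_)
open import Data.Nat.Base using (_*_)

open import Data.Bool.Base using (if_then_else_)
open import Data.Empty using (⊥-elim)
open import Data.Fin.Base using (zero; suc)
open import Data.Fin.Properties using (_≟_; _<?_; <-cmp; +↔⊎)
open import Data.Fin.Permutation using (permutation; ↔⇒≡)
open import Data.Nat.Properties using (+-0-commutativeMonoid; +-identityʳ)
open import Data.Product using (_,_)
open import Data.Product.Function.Dependent.Propositional using (Σ-↔)
open import Data.Sum.Base using (_⊎_; inj₁; inj₂)
open import Data.Sum.Function.Propositional using (_⊎-↔_)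
open import Function.Base using (_∘_)
open import Function.Bundles using (Inverse; mk↔ₛ′)
open import Function.Properties.Inverse using (↔-refl; ↔-sym; ↔-trans; ↔⇒↣)
open import Relation.Binary.Definitions using (Tri; tri<; tri≈; tri>)
open import Relation.Binary.PropositionalEquality using (refl; sym; trans; cong; cong₂; module ≡-Reasoning)
open import Relation.Nullary using (Dec; yes; no; ¬_; does; contradiction)
open import Relation.Nullary.Decidable using (map′; via-injection)
import Relation.Nullary.Irrelevant as Nullary
open import Relation.Unary using (Pred; Decidable; Irrelevant)
open import Axiom.UniquenessOfIdentityProofs using (module Decidable⇒UIP)
open import Algebra.Properties.CommutativeMonoid.Sum +-0-commutativeMonoid using (sum; sum-cong-≗; ∑-distrib-+; sum-permute)

indicator : ∀ {p} {P : Set p} → Dec P → ℕ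
indicator P? = if does P? then 1 else 0

indicator-yes : ∀ {p} {P : Set p} → P → (P? : Dec P) → indicator P? ≡ 1
indicator-yes _ (yes _) = refl
indicator-yes p (no ¬p) = contradiction p ¬p

indicator-no : ∀ {p} {P : Set p} → ¬ P → (P? : Dec P) → indicator P? ≡ 0
indicator-no ¬p (yes p) = contradiction p ¬p
indicator-no _  (no _)  = refl

indicator-tri : ∀ {a b c} {A : Set a} {B : Set b} {C : Set c} → Tri A B C →
                (A? : Dec A) (B? : Dec B) (C? : Dec C) →
                indicator A? + indicator C? + indicator B? ≡ 1
indicator-tri (tri< a ¬b ¬c) A? B? C? =
  cong₂ _+_ (cong₂ _+_ (indicator-yes a A?) (indicator-no ¬c C?)) (indicator-no ¬b B?)
indicator-tri (tri≈ ¬a b ¬c) A? B? C? =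
  cong₂ _+_ (cong₂ _+_ (indicator-no ¬a A?) (indicator-no ¬c C?)) (indicator-yes b B?)
indicator-tri (tri> ¬a ¬b c) A? B? C? =
  cong₂ _+_ (cong₂ _+_ (indicator-no ¬a A?) (indicator-yes c C?)) (indicator-no ¬b B?)

count : ∀ {n p} {P : Pred (Fin n) p} → Decidable P → ℕ
count P? = sum (λ i → indicator (P? i))

sum-ones : ∀ n → sum {n} (λ _ → 1) ≡ n
sum-ones ℕ.zero    = refl
sum-ones (ℕ.suc n) = cong ℕ.suc (sum-ones n)

Dec↔Fin-indicator : ∀ {p} {P : Set p} → Nullary.Irrelevant P → (P? : Dec P) → P ↔ Fin (indicator P?)
Dec↔Fin-indicator irr (yes p) = mk↔ₛ′ (λ _ → zero) (λ _ → p) (λ { zero → refl ; (suc ()) }) (irr p)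
Dec↔Fin-indicator _   (no ¬p) = mk↔ₛ′ (⊥-elim ∘ ¬p) (λ ()) (λ ()) (λ p → contradiction p ¬p)

Σ-Fin-suc↔ : ∀ {n p} {P : Pred (Fin (ℕ.suc n)) p} → Σ (Fin (ℕ.suc n)) P ↔ (P zero ⊎ Σ (Fin n) (P ∘ suc))
Σ-Fin-suc↔ = mk↔ₛ′
  (λ { (zero , p) → inj₁ p ; (suc i , p) → inj₂ (i , p) })
  (λ { (inj₁ p) → zero , p ; (inj₂ (i , p)) → suc i , p })
  (λ { (inj₁ _) → refl ; (inj₂ _) → refl })
  (λ { (zero , _) → refl ; (suc _ , _) → refl })

Σ-Fin↔count : ∀ {n p} {P : Pred (Fin n) p} → Irrelevant P → (P? : Decidable P) → Σ (Fin n) P ↔ Fin (count P?)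
Σ-Fin↔count {ℕ.zero}  _   _  = mk↔ₛ′ (λ { (() , _) }) (λ ()) (λ ()) (λ { (() , _) })
Σ-Fin↔count {ℕ.suc n} irr P? =
  ↔-trans Σ-Fin-suc↔
    (↔-trans (Dec↔Fin-indicator irr (P? zero) ⊎-↔ Σ-Fin↔count irr (P? ∘ suc))
             (↔-sym +↔⊎))

involution-parity : ∀ {n} (f : Fin n → Fin n) → (∀ i → f (f i) ≡ i) →
                    ∃ λ j → n ≡ 2 * j + count (λ i → f i ≟ i)
involution-parity {n} f f-inv = sum below , (begin
  n                                                  ≡⟨ sym (sum-ones n) ⟩
  sum {n} (λ _ → 1)                                  ≡⟨ sym (sum-cong-≗ classify) ⟩
  sum (λ i → below i + above i + fixed i)            ≡⟨ ∑-distrib-+ (λ i → below i + above i) fixed ⟩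
  sum (λ i → below i + above i) + count fixed?       ≡⟨ cong (_+ count fixed?) (∑-distrib-+ below above) ⟩
  sum below + sum above + count fixed?               ≡⟨ cong (λ s → sum below + s + count fixed?) above≡below ⟩
  sum below + sum below + count fixed?               ≡⟨ cong (λ s → sum below + s + count fixed?) (sym (+-identityʳ _)) ⟩
  2 * sum below + count fixed?                       ∎)
  where
  open ≡-Reasoning

  fixed? : Decidable (λ i → f i ≡ i)
  fixed? i = f i ≟ i

  below above fixed : Fin n → ℕ
  below i = indicator (i <? f i)
  above i = indicator (f i <? i)
  fixed i = indicator (fixed? i)

  classify : ∀ i → below i + above i + fixed i ≡ 1
  classify i = indicator-tri (<-cmp i (f i)) (i <? f i) (map′ sym sym (fixed? i)) (f i <? i)

  -- f maps the indices above their image bijectively onto those below it.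
  above≡below : sum above ≡ sum below
  above≡below = trans (sum-cong-≗ λ i → cong (λ j → indicator (f i <? j)) (sym (f-inv i)))
                      (sym (sum-permute below (permutation f f f-inv f-inv)))

finite-involution-parity : ∀ {a n k} {A : Set a} {σ : A → A} → (∀ x → σ (σ x) ≡ x) →
                           A ↔ Fin n → Σ A (λ x → σ x ≡ x) ↔ Fin k →
                           ∃ λ j → n ≡ 2 * j + k
finite-involution-parity {n = n} {k} {σ = σ} σ-inv A↔Fin Fix↔Fin =
  let j , n≡ = involution-parity f f-inv in j , trans n≡ (cong (2 * j +_) count≡k)
  where
  open Inverse A↔Fin using (to; from; strictlyInverseˡ; strictlyInverseʳ)

  f : Fin n → Fin n
  f = to ∘ σ ∘ from

  f-inv : ∀ i → f (f i) ≡ i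
  f-inv i = begin
    to (σ (from (to (σ (from i))))) ≡⟨ cong (to ∘ σ) (strictlyInverseʳ (σ (from i))) ⟩
    to (σ (σ (from i)))             ≡⟨ cong to (σ-inv (from i)) ⟩
    to (from i)                     ≡⟨ strictlyInverseˡ i ⟩
    i                               ∎
    where open ≡-Reasoning

  fixed-from : ∀ {i} → f i ≡ i → σ (from i) ≡ from i
  fixed-from {i} e = trans (sym (strictlyInverseʳ (σ (from i)))) (cong from e)

  fixed-to : ∀ {i} → σ (from i) ≡ from i → f i ≡ i
  fixed-to {i} e = trans (cong to e) (strictlyInverseˡ i)

  -- Deciding fixedness of from i through f i ≟ i makes its count agree with that of f.
  fixed? : Decidable (λ i → σ (from i) ≡ from i)
  fixed? i = map′ fixed-from fixed-to (f i ≟ i)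

  fixed-irrelevant : Irrelevant (λ i → σ (from i) ≡ from i)
  fixed-irrelevant = Decidable⇒UIP.≡-irrelevant (via-injection (↔⇒↣ A↔Fin) _≟_)

  count≡k : count (λ i → f i ≟ i) ≡ k
  count≡k = ↔⇒≡ (↔-trans (↔-sym (Σ-Fin↔count fixed-irrelevant fixed?))
                         (↔-trans (Σ-↔ (↔-sym A↔Fin) ↔-refl) Fix↔Fin))

proposition3p19 : ∀ {a : Level} (Q : QBAlgebra a) → Flat Q → (n k : ℕ) →
    (QBAlgebra.Carrier Q ↔ Fin n) →
    (Σ (QBAlgebra.Carrier Q) (λ x → QBAlgebra._* Q x ≡ x) ↔ Fin k) →
    (∃ λ m → (∃ λ j → m ≡ 2 * j) × (n ≡ m + k))
    × (k ≡ 1 → ∃ λ j → n ≡ 2 * j + 1)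
proposition3p19 Q _ n k Q↔Fin Fix↔Fin with finite-involution-parity (QBAlgebra.*-invol Q) Q↔Fin Fix↔Fin
... | j , n≡ = (2 * j , (j , refl) , n≡) , λ { refl → j , n≡ }
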